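{- Let $n\ge4$ be an integer, let $\beta$ be the largest real root of $p_n(x)=x^3-(n+1)x^2+nx-n$, $\alpha=\beta-n$, $f(l,k,j)=l-\alpha k+\frac{\alpha}{\beta}j$, $U=\{(l,k,j)\in\mathbb{Z}^3: f(l,k,j)\in[0,1)\}$ and $U^*=U\setminus\{(0,0,0)\}$. Define $\tau_\beta:U\to U$ by $\tau_\beta(l,k,j)=(l',k',j')$ where $k'=k-j-l$, $j'=k$, and $l'=0$ if $k'=j'=0$, while $l'=1+\lfloor k'\alpha-j'\alpha/\beta\rfloor$ otherwise. Let $(l_0,k_0,j_0)\in U^*$ and define $(l_{i+1},k_{i+1},j_{i+1})=\tau_\beta(l_i,k_i,j_i)$, and suppose $(l_i,k_i,j_i)\in U^*$ for $0\le i\le5$. If $k_0>0$, $j_0>0$ and $k_1<0$, then $k_2<0$, $k_4>0$ and $k_5>0$. -}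

module Defs where

open import Data.Nat as ℕ using (ℕ)
open import Data.Integer as ℤ using (ℤ; +_)
open import Data.Rational as ℚ using (ℚ; 0ℚ; 1ℚ; _+_; _*_; _-_; _<_; _≤_)
open import Data.Rational.Properties using (_≟_)
open import Data.Product using (Σ; _×_; _,_)
open import Relation.Nullary using (¬_; yes; no)
open import Relation.Binary.PropositionalEquality using (_≡_)

ℤ→ℚ : ℤ → ℚ
ℤ→ℚ z = z ℚ./ 1

ℕ→ℚ : ℕ → ℚ
ℕ→ℚ m = (+ m) ℚ./ 1

-- Total reciprocal (1/0 := 0); only ever evaluated at t > 0 below.
inv : ℚ → ℚ
inv t with t ≟ 0ℚ
... | yes _ = 0ℚ
... | no t≢0 = ℚ._÷_ 1ℚ t {{ℚ.≢-nonZero t≢0}}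

p : ℕ → ℚ → ℚ
p n x = x * x * x - ℕ→ℚ (ℕ.suc n) * (x * x) + ℕ→ℚ n * x - ℕ→ℚ n

-- β = the largest real root of p_n, represented by rational brackets.
-- A bracket (r , s) satisfies: 0 < r, p_n(r) < 0, and p_n(t) ≥ ε > 0 for
-- every rational t ≥ s.  Hence p_n has no real root ≥ s and has a root
-- > r, i.e. the largest real root β lies in (r , s).  Conversely
-- arbitrarily tight such brackets exist.

record Bracket (n : ℕ) : Set where
  field
    r s ε  : ℚ
    0<r    : 0ℚ < r
    p[r]<0 : p n r < 0ℚ
    0<ε    : 0ℚ < ε
    above  : ∀ t → s ≤ t → ε ≤ p n t

-- A "real expression in β" is given as a rational function g : ℚ → ℚ
-- (continuous on (0,∞)); its value at β is g(β).

GtAtβ : ℕ → (ℚ → ℚ) → ℚ → Set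
GtAtβ n g c = Σ (Bracket n) λ B → Σ ℚ λ δ → (0ℚ < δ) ×
  (∀ t → Bracket.r B ≤ t → t ≤ Bracket.s B → c + δ ≤ g t)

LtAtβ : ℕ → (ℚ → ℚ) → ℚ → Set
LtAtβ n g c = Σ (Bracket n) λ B → Σ ℚ λ δ → (0ℚ < δ) ×
  (∀ t → Bracket.r B ≤ t → t ≤ Bracket.s B → g t + δ ≤ c)

GeAtβ : ℕ → (ℚ → ℚ) → ℚ → Set
GeAtβ n g c = ¬ LtAtβ n g c

FloorAtβ : ℕ → (ℚ → ℚ) → ℤ → Set
FloorAtβ n g m = GeAtβ n g (ℤ→ℚ m) × LtAtβ n g (ℤ→ℚ (m ℤ.+ ℤ.1ℤ))

α : ℕ → ℚ → ℚ
α n t = t - ℕ→ℚ n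

α/β : ℕ → ℚ → ℚ
α/β n t = α n t * inv t

f : ℕ → ℤ → ℤ → ℤ → ℚ → ℚ
f n l k j t = ℤ→ℚ l - α n t * ℤ→ℚ k + α/β n t * ℤ→ℚ j

Triple : Set
Triple = ℤ × ℤ × ℤ

InU : ℕ → Triple → Set
InU n (l , k , j) = GeAtβ n (f n l k j) 0ℚ × LtAtβ n (f n l k j) 1ℚ

InU* : ℕ → Triple → Set
InU* n x = InU n x × ¬ (x ≡ (ℤ.0ℤ , ℤ.0ℤ , ℤ.0ℤ))

Tau : ℕ → Triple → Triple → Set
Tau n (l , k , j) (l' , k' , j') =
  (k' ≡ k ℤ.- j ℤ.- l) × (j' ≡ k) ×
  ((k' ≡ ℤ.0ℤ × j' ≡ ℤ.0ℤ) → l' ≡ ℤ.0ℤ) ×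
  (¬ (k' ≡ ℤ.0ℤ × j' ≡ ℤ.0ℤ) →
     FloorAtβ n (λ t → α n t * ℤ→ℚ k' - α/β n t * ℤ→ℚ j') (l' ℤ.- ℤ.1ℤ))

module Submission where

-- On k-coordinates τ_β is a rounded linear recurrence: with c = 1 − α and d = 1 − α/β,
-- f(l, k, j) = c k − d j − k′ for the next coordinate k′ = k − j − l, so f ∈ (0, 1) says that
-- k′ is the integer strictly between c k − d j − 1 and c k − d j. For n ≥ 4 the root β lies in
-- (n, n + 3/10), which gives 7/10 ≤ c and 3 + c ≤ 4d ≤ 4. Starting from k₀ ≥ 1 and k₁ ≤ −1,
-- integrality sharpens each bound: k₂ ≤ −2, k₃ ≥ k₂ − k₁, k₄ ≥ 1. For k₅ one splits on the sign
-- of k₃: k₃ ≥ 0 forces k₁ ≤ −2, k₂ ≤ −3 and k₄ ≥ 2, and k₃ ≥ 1 even k₂ ≤ −4, after which c k₅ is a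
-- positive combination of known quantities. Every step is a polynomial inequality in c and d.
-- Since β is given only through rational brackets, the argument runs at one rational point
-- lying in all the brackets involved.

module _ where

  open import Agda.Builtin.FromNat using (Number; fromNat)
  open import Agda.Builtin.FromNeg using (fromNeg) renaming (Negative to NegativeLiterals)
  open import Data.Empty using (⊥-elim)
  open import Data.Integer as ℤ using (ℤ; +_; -[1+_])
  import Data.Integer.Literals as ℤLiterals
  import Data.Integer.Properties as ℤ
  open import Data.List using ([]; _∷_)
  open import Data.Nat as ℕ using (ℕ; suc)
  import Data.Nat.Coprimality as Coprimality
  import Data.Nat.Literals as ℕLiterals
  open import Data.Product using (Σ; Σ-syntax; _×_; _,_; proj₂)
  open import Data.Rational
  open import Data.Rational.Literals using (fromℤ)
  import Data.Rational.Literals as ℚLiterals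
  open import Data.Rational.Properties
  open import Data.Sum using (inj₁; inj₂)
  open import Data.Unit using (tt)
  open import Function using (_∘_)
  open import Level using (0ℓ)
  open import Relation.Binary.PropositionalEquality
  open import Relation.Nullary using (¬_)
  open import Relation.Nullary.Decidable using (dec⇒maybe; yes; no)
  open import Tactic.RingSolver using (solve)
  open import Tactic.RingSolver.Core.AlmostCommutativeRing
    using (AlmostCommutativeRing; fromCommutativeRing)

  open import Defs hiding (p)
  import Defs

  instance
    ℕ-number : Number ℕ
    ℕ-number = ℕLiterals.number

    ℤ-number : Number ℤ
    ℤ-number = ℤLiterals.number

    ℤ-negative : NegativeLiterals ℤ
    ℤ-negative = ℤLiterals.negative

    ℚ-number : Number ℚ
    ℚ-number = ℚLiterals.number

    ℚ-negative : NegativeLiterals ℚ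
    ℚ-negative = ℚLiterals.negative

  ℚ-ring : AlmostCommutativeRing 0ℓ 0ℓ
  ℚ-ring = fromCommutativeRing +-*-commutativeRing (dec⇒maybe ∘ (0ℚ ≟_))

  private
    variable
      p q : ℚ

  p≤q⇒0≤q-p : p ≤ q → 0 ≤ q - p
  p≤q⇒0≤q-p {p} {q} p≤q = subst (_≤ q - p) (+-inverseʳ p) (+-monoˡ-≤ (- p) p≤q)

  p<q⇒0<q-p : p < q → 0 < q - p
  p<q⇒0<q-p {p} {q} p<q = subst (_< q - p) (+-inverseʳ p) (+-monoˡ-< (- p) p<q)

  q-p+p≡q : ∀ p q → q - p + p ≡ q
  q-p+p≡q p q = solve (p ∷ q ∷ []) ℚ-ring

  0≤q-p⇒p≤q : 0 ≤ q - p → p ≤ q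
  0≤q-p⇒p≤q {q} {p} 0≤q-p = subst₂ _≤_ (+-identityˡ p) (q-p+p≡q p q) (+-monoˡ-≤ p 0≤q-p)

  0<q-p⇒p<q : 0 < q - p → p < q
  0<q-p⇒p<q {q} {p} 0<q-p = subst₂ _<_ (+-identityˡ p) (q-p+p≡q p q) (+-monoˡ-< p 0<q-p)

  0<p*q⇒0<q : 0 ≤ p → 0 < p * q → 0 < q
  0<p*q⇒0<q {p} {q} 0≤p 0<p*q =
    *-cancelˡ-<-nonNeg p {{nonNegative 0≤p}} (subst (_< p * q) (sym (*-zeroʳ p)) 0<p*q)

  infixl 6 _⊕_ _⊕⁺_
  infixl 7 _⊛_ _⊙_

  _⊕_ : 0 ≤ p → 0 ≤ q → 0 ≤ p + q
  _⊕_ = +-mono-≤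

  _⊕⁺_ : 0 ≤ p → 0 < q → 0 < p + q
  _⊕⁺_ = +-mono-≤-<

  _⊛_ : 0 ≤ p → 0 ≤ q → 0 ≤ p * q
  _⊛_ {p} {q} 0≤p 0≤q =
    nonNegative⁻¹ (p * q) {{nonNeg*nonNeg⇒nonNeg p {{nonNegative 0≤p}} q {{nonNegative 0≤q}}}}

  _⊙_ : ∀ k .{{_ : NonNegative k}} → 0 ≤ p → 0 ≤ k * p
  k ⊙ 0≤p = nonNegative⁻¹ k ⊛ 0≤p

  ℤ→ℚ≡fromℤ : ∀ m → ℤ→ℚ m ≡ fromℤ m
  ℤ→ℚ≡fromℤ (+ n)    = normalize-coprime (Coprimality.sym (Coprimality.1-coprimeTo n))
  ℤ→ℚ≡fromℤ -[1+ n ] =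
    cong -_ (normalize-coprime (Coprimality.sym (Coprimality.1-coprimeTo (suc n))))

  ℤ→ℚ-+ : ∀ m n → ℤ→ℚ (m ℤ.+ n) ≡ ℤ→ℚ m + ℤ→ℚ n
  ℤ→ℚ-+ m n rewrite ℤ→ℚ≡fromℤ m | ℤ→ℚ≡fromℤ n =
    cong ℤ→ℚ (sym (cong₂ ℤ._+_ (ℤ.*-identityʳ m) (ℤ.*-identityʳ n)))

  fromℤ-neg : ∀ m → fromℤ (ℤ.- m) ≡ - fromℤ m
  fromℤ-neg (+ 0)    = refl
  fromℤ-neg (+ suc n) = refl
  fromℤ-neg -[1+ n ] = refl

  ℤ→ℚ-neg : ∀ m → ℤ→ℚ (ℤ.- m) ≡ - ℤ→ℚ m
  ℤ→ℚ-neg m rewrite ℤ→ℚ≡fromℤ (ℤ.- m) | ℤ→ℚ≡fromℤ m = fromℤ-neg m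

  ℤ→ℚ-‿ : ∀ m n → ℤ→ℚ (m ℤ.- n) ≡ ℤ→ℚ m - ℤ→ℚ n
  ℤ→ℚ-‿ m n = trans (ℤ→ℚ-+ m (ℤ.- n)) (cong (_+_ (ℤ→ℚ m)) (ℤ→ℚ-neg n))

  ℤ→ℚ-mono-≤ : ∀ {m n} → m ℤ.≤ n → ℤ→ℚ m ≤ ℤ→ℚ n
  ℤ→ℚ-mono-≤ {m} {n} m≤n rewrite ℤ→ℚ≡fromℤ m | ℤ→ℚ≡fromℤ n =
    *≤* (subst₂ ℤ._≤_ (sym (ℤ.*-identityʳ m)) (sym (ℤ.*-identityʳ n)) m≤n)

  ℤ→ℚ-cancel-< : ∀ {m n} → ℤ→ℚ m < ℤ→ℚ n → m ℤ.< n
  ℤ→ℚ-cancel-< {m} {n} m<n rewrite ℤ→ℚ≡fromℤ m | ℤ→ℚ≡fromℤ n with m<n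
  ... | *<* m*1<n*1 = subst₂ ℤ._<_ (ℤ.*-identityʳ m) (ℤ.*-identityʳ n) m*1<n*1

  IsInteger : ℚ → Set
  IsInteger x = Σ[ m ∈ ℤ ] ℤ→ℚ m ≡ x

  isInteger-‿ : IsInteger p → IsInteger q → IsInteger (p - q)
  isInteger-‿ (m , refl) (n , refl) = m ℤ.- n , ℤ→ℚ-‿ m n

  <+1⇒≤ : IsInteger p → IsInteger q → p < q + 1 → p ≤ q
  <+1⇒≤ (m , refl) (n , refl) m<n+1 =
    ℤ→ℚ-mono-≤ (subst (m ℤ.≤_) (ℤ.pred-suc n) (ℤ.i<j⇒i≤pred[j] m<suc[n]))
    where
    m<suc[n] : m ℤ.< ℤ.suc n
    m<suc[n] = ℤ→ℚ-cancel-< (subst (ℤ→ℚ m <_) (trans (+-comm (ℤ→ℚ n) 1) (sym (ℤ→ℚ-+ 1 n))) m<n+1)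

  -1<⇒≤ : IsInteger p → IsInteger q → p - 1 < q → p ≤ q
  -1<⇒≤ {p} {q} ℤp ℤq p-1<q = <+1⇒≤ ℤp ℤq (subst (_< q + 1) (q-p+p≡q 1 p) (+-monoˡ-< 1 p-1<q))

  -- The k-recurrence

  -- Satisfied by c = 1 − α and d = 1 − α/β when β ∈ [n, n + 3/10] and n ≥ 4.
  record Coefficients (c d : ℚ) : Set where
    field
      7/10≤c : 7 / 10 ≤ c
      3+c≤4d : 3 + c ≤ 4 * d
      d≤1    : d ≤ 1

  -- With l = y − x − z, the gap c y − d x − z is f(l, y, x).
  record Step (c d x y z : ℚ) : Set where
    field
      0<gap : 0 < c * y - d * x - z
      gap<1 : c * y - d * x - z < 1

  module Orbit {c d : ℚ} (coefficients : Coefficients c d) where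

    open Coefficients coefficients
    open Step

    0≤c-7/10 : 0 ≤ c - 7 / 10
    0≤c-7/10 = p≤q⇒0≤q-p 7/10≤c

    0≤4d-[3+c] : 0 ≤ 4 * d - (3 + c)
    0≤4d-[3+c] = p≤q⇒0≤q-p 3+c≤4d

    0≤1-d : 0 ≤ 1 - d
    0≤1-d = p≤q⇒0≤q-p d≤1

    -- Inequalities between coefficients are certified by nonnegative combinations of products of
    -- c − 7/10, 4d − (3 + c), 1 − d and 1 − c.

    0≤1-c : 0 ≤ 1 - c
    0≤1-c = subst (0 ≤_) identity (0≤4d-[3+c] ⊕ 4 ⊙ 0≤1-d)
      where
      identity : 4 * d - (3 + c) + 4 * (1 - d) ≡ 1 - c
      identity = solve (c ∷ d ∷ []) ℚ-ring

    0≤c : 0 ≤ c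
    0≤c = ≤-trans (nonNegative⁻¹ (7 / 10)) 7/10≤c

    0≤d : 0 ≤ d
    0≤d = subst (0 ≤_) identity (1 / 4 ⊙ 0≤4d-[3+c] ⊕ 1 / 4 ⊙ 0≤c-7/10 ⊕ nonNegative⁻¹ (37 / 40))
      where
      identity : 1 / 4 * (4 * d - (3 + c)) + 1 / 4 * (c - 7 / 10) + 37 / 40 ≡ d
      identity = solve (c ∷ d ∷ []) ℚ-ring

    0≤d-c : 0 ≤ d - c
    0≤d-c = subst (0 ≤_) identity (1 / 4 ⊙ 0≤4d-[3+c] ⊕ 3 / 4 ⊙ 0≤1-c)
      where
      identity : 1 / 4 * (4 * d - (3 + c)) + 3 / 4 * (1 - c) ≡ d - c
      identity = solve (c ∷ d ∷ []) ℚ-ring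

    0≤d-c² : 0 ≤ d - c * c
    0≤d-c² = subst (0 ≤_) identity (0≤d-c ⊕ 0≤c ⊛ 0≤1-c)
      where
      identity : d - c + c * (1 - c) ≡ d - c * c
      identity = solve (c ∷ d ∷ []) ℚ-ring

    0≤2d-c-1 : 0 ≤ 2 * d - c - 1
    0≤2d-c-1 = subst (0 ≤_) identity (1 / 2 ⊙ 0≤4d-[3+c] ⊕ 1 / 2 ⊙ 0≤1-c)
      where
      identity : 1 / 2 * (4 * d - (3 + c)) + 1 / 2 * (1 - c) ≡ 2 * d - c - 1
      identity = solve (c ∷ d ∷ []) ℚ-ring

    0≤c[1-c]-[1-d] : 0 ≤ c * (1 - c) - (1 - d)
    0≤c[1-c]-[1-d] = subst (0 ≤_) identity (0≤c-7/10 ⊛ 0≤1-c ⊕ 9 / 20 ⊙ 0≤1-c ⊕ 1 / 4 ⊙ 0≤4d-[3+c])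
      where
      identity : (c - 7 / 10) * (1 - c) + 9 / 20 * (1 - c) + 1 / 4 * (4 * d - (3 + c))
               ≡ c * (1 - c) - (1 - d)
      identity = solve (c ∷ d ∷ []) ℚ-ring

    0≤c²+cd-d : 0 ≤ c * c + c * d - d
    0≤c²+cd-d = subst (0 ≤_) identity
      (0≤c-7/10 ⊛ 0≤c-7/10 ⊕ 12 / 5 ⊙ 0≤c-7/10 ⊕ 0≤1-c ⊛ 0≤1-d ⊕ nonNegative⁻¹ (19 / 100))
      where
      identity : (c - 7 / 10) * (c - 7 / 10) + 12 / 5 * (c - 7 / 10) + (1 - c) * (1 - d) + 19 / 100
               ≡ c * c + c * d - d
      identity = solve (c ∷ d ∷ []) ℚ-ring

    0<3c²+c+d²-3d : 0 < 3 * (c * c) + c + d * d - 3 * d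
    0<3c²+c+d²-3d = subst (0 <_) identity
      (3 ⊙ 0≤c-7/10 ⊛ 0≤c-7/10 ⊕ 26 / 5 ⊙ 0≤c-7/10 ⊕ 0≤1-d ⊕ 0≤1-d ⊛ 0≤1-d ⊕⁺ positive⁻¹ (17 / 100))
      where
      identity :
        3 * (c - 7 / 10) * (c - 7 / 10) + 26 / 5 * (c - 7 / 10) + (1 - d) + (1 - d) * (1 - d)
        + 17 / 100
        ≡ 3 * (c * c) + c + d * d - 3 * d
      identity = solve (c ∷ d ∷ []) ℚ-ring

    0≤G₁ : let e = d - c * c in 0 ≤ c * c * d - e * e
    0≤G₁ = subst (0 ≤_) identity
      ( 2551 / 1000 ⊙ 0≤c-7/10
      ⊕ 91 / 60 ⊙ 0≤1-c ⊛ 0≤1-d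
      ⊕ 4 / 75 ⊙ 0≤c-7/10 ⊛ 0≤c-7/10
      ⊕ 5 / 6 ⊙ 0≤c-7/10 ⊛ 0≤4d-[3+c]
      ⊕ 1 / 4 ⊙ 0≤1-d ⊛ 0≤4d-[3+c]
      ⊕ 37 / 10 ⊙ 0≤1-c ⊛ 0≤c-7/10 ⊛ 0≤c-7/10
      ⊕ 3 ⊙ 0≤1-c ⊛ 0≤c-7/10 ⊛ 0≤1-d
      ⊕ 0≤1-c ⊛ 0≤1-c ⊛ 0≤1-c ⊛ 0≤c-7/10
      ⊕ nonNegative⁻¹ (2299 / 10000))
      where
      identity :
        let a  = c - 7 / 10
            a′ = 1 - c
            b  = 1 - d
            w  = 4 * d - (3 + c)
            e  = d - c * c
        in
          2551 / 1000 * a + 91 / 60 * a′ * b + 4 / 75 * a * a + 5 / 6 * a * w + 1 / 4 * b * w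
        + 37 / 10 * a′ * a * a + 3 * a′ * a * b + a′ * a′ * a′ * a + 2299 / 10000
        ≡ c * c * d - e * e
      identity = solve (c ∷ d ∷ []) ℚ-ring

    0<G₂ : let e = d - c * c in 0 < 4 * (c * c * d - e * e) + e * d * d - c * c - c
    0<G₂ = subst (0 <_) identity
      ( 37583 / 6400 ⊙ 0≤c-7/10
      ⊕ 943 / 960 ⊙ 0≤1-c ⊛ 0≤c-7/10
      ⊕ 25 / 6 ⊙ 0≤c-7/10 ⊛ 0≤4d-[3+c]
      ⊕ 97 / 240 ⊙ 0≤1-d ⊛ 0≤4d-[3+c]
      ⊕ 8497 / 576 ⊙ 0≤1-c ⊛ 0≤c-7/10 ⊛ 0≤c-7/10
      ⊕ 85 / 9 ⊙ 0≤1-c ⊛ 0≤c-7/10 ⊛ 0≤1-d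
      ⊕ 17 / 576 ⊙ 0≤1-c ⊛ 0≤4d-[3+c] ⊛ 0≤4d-[3+c]
      ⊕ 23 / 72 ⊙ 0≤c-7/10 ⊛ 0≤1-d ⊛ 0≤4d-[3+c]
      ⊕ 1 / 4 ⊙ 0≤1-d ⊛ 0≤1-d ⊛ 0≤4d-[3+c]
      ⊕ 65 / 16 ⊙ 0≤1-c ⊛ 0≤1-c ⊛ 0≤1-c ⊛ 0≤c-7/10
      ⊕ 1 / 16 ⊙ 0≤1-c ⊛ 0≤1-c ⊛ 0≤1-c ⊛ 0≤4d-[3+c]
      ⊕ 1 / 4 ⊙ 0≤1-c ⊛ 0≤1-c ⊛ 0≤1-d ⊛ 0≤4d-[3+c]
      ⊕⁺ positive⁻¹ (15251 / 64000))
      where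
      identity :
        let a  = c - 7 / 10
            a′ = 1 - c
            b  = 1 - d
            w  = 4 * d - (3 + c)
            e  = d - c * c
        in
          37583 / 6400 * a + 943 / 960 * a′ * a + 25 / 6 * a * w + 97 / 240 * b * w
        + 8497 / 576 * a′ * a * a + 85 / 9 * a′ * a * b + 17 / 576 * a′ * w * w
        + 23 / 72 * a * b * w + 1 / 4 * b * b * w + 65 / 16 * a′ * a′ * a′ * a
        + 1 / 16 * a′ * a′ * a′ * w + 1 / 4 * a′ * a′ * b * w + 15251 / 64000
        ≡ 4 * (c * c * d - e * e) + e * d * d - c * c - c
      identity = solve (c ∷ d ∷ []) ℚ-ring

    c*-1-d*1≤-1 : c * -1 - d * 1 ≤ -1
    c*-1-d*1≤-1 = 0≤q-p⇒p≤q
      (subst (0 ≤_) identity (5 / 4 ⊙ 0≤c-7/10 ⊕ 1 / 4 ⊙ 0≤4d-[3+c] ⊕ nonNegative⁻¹ (5 / 8)))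
      where
      identity : 5 / 4 * (c - 7 / 10) + 1 / 4 * (4 * d - (3 + c)) + 5 / 8 ≡ -1 - (c * -1 - d * 1)
      identity = solve (c ∷ d ∷ []) ℚ-ring

    c*-2-d*1≤-2 : c * -2 - d * 1 ≤ -2
    c*-2-d*1≤-2 = 0≤q-p⇒p≤q
      (subst (0 ≤_) identity (9 / 4 ⊙ 0≤c-7/10 ⊕ 1 / 4 ⊙ 0≤4d-[3+c] ⊕ nonNegative⁻¹ (13 / 40)))
      where
      identity : 9 / 4 * (c - 7 / 10) + 1 / 4 * (4 * d - (3 + c)) + 13 / 40 ≡ -2 - (c * -2 - d * 1)
      identity = solve (c ∷ d ∷ []) ℚ-ring

    0≤c*1-d*-1-1 : 0 ≤ c * 1 - d * -1 - 1
    0≤c*1-d*-1-1 =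
      subst (0 ≤_) identity (5 / 4 ⊙ 0≤c-7/10 ⊕ 1 / 4 ⊙ 0≤4d-[3+c] ⊕ nonNegative⁻¹ (5 / 8))
      where
      identity : 5 / 4 * (c - 7 / 10) + 1 / 4 * (4 * d - (3 + c)) + 5 / 8 ≡ c * 1 - d * -1 - 1
      identity = solve (c ∷ d ∷ []) ℚ-ring

    1≤c*0-d*-3-1 : 1 ≤ c * 0 - d * -3 - 1
    1≤c*0-d*-3-1 = 0≤q-p⇒p≤q
      (subst (0 ≤_) identity (3 / 4 ⊙ 0≤4d-[3+c] ⊕ 3 / 4 ⊙ 0≤c-7/10 ⊕ nonNegative⁻¹ (31 / 40)))
      where
      identity : 3 / 4 * (4 * d - (3 + c)) + 3 / 4 * (c - 7 / 10) + 31 / 40 ≡ c * 0 - d * -3 - 1 - 1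
      identity = solve (c ∷ d ∷ []) ℚ-ring

    0≤c*2-d*0-1 : 0 ≤ c * 2 - d * 0 - 1
    0≤c*2-d*0-1 = subst (0 ≤_) identity (2 ⊙ 0≤c-7/10 ⊕ nonNegative⁻¹ (2 / 5))
      where
      identity : 2 * (c - 7 / 10) + 2 / 5 ≡ c * 2 - d * 0 - 1
      identity = solve (c ∷ d ∷ []) ℚ-ring

    step-upper-bound : ∀ {x y z p q} → y ≤ p → q ≤ x → Step c d x y z → z < c * p - d * q
    step-upper-bound {x} {y} {z} {p} {q} y≤p q≤x s =
      0<q-p⇒p<q (subst (0 <_) identity (0≤c ⊛ p≤q⇒0≤q-p y≤p ⊕ 0≤d ⊛ p≤q⇒0≤q-p q≤x ⊕⁺ 0<gap s))
      where
      identity : c * (p - y) + d * (x - q) + (c * y - d * x - z) ≡ c * p - d * q - z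
      identity = solve (c ∷ d ∷ x ∷ y ∷ z ∷ p ∷ q ∷ []) ℚ-ring

    step-lower-bound : ∀ {x y z p q} → p ≤ y → x ≤ q → Step c d x y z → c * p - d * q - 1 < z
    step-lower-bound {x} {y} {z} {p} {q} p≤y x≤q s =
      0<q-p⇒p<q (subst (0 <_) identity
        (0≤c ⊛ p≤q⇒0≤q-p p≤y ⊕ 0≤d ⊛ p≤q⇒0≤q-p x≤q ⊕⁺ p<q⇒0<q-p (gap<1 s)))
      where
      identity : c * (y - p) + d * (q - x) + (1 - (c * y - d * x - z)) ≡ z - (c * p - d * q - 1)
      identity = solve (c ∷ d ∷ x ∷ y ∷ z ∷ p ∷ q ∷ []) ℚ-ring

    x₂-x₁-1<x₃ : ∀ {x₀ x₁ x₂ x₃} → 1 ≤ x₀ → x₁ ≤ -1 →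
      Step c d x₀ x₁ x₂ → Step c d x₁ x₂ x₃ → x₂ - x₁ - 1 < x₃
    x₂-x₁-1<x₃ {x₀} {x₁} {x₂} {x₃} 1≤x₀ x₁≤-1 s₁ s₂ = 0<q-p⇒p<q (subst (0 <_) identity
      ( 0≤c[1-c]-[1-d] ⊛ p≤q⇒0≤q-p x₁≤-1
      ⊕ 0≤c[1-c]-[1-d]
      ⊕ 0≤1-c ⊛ 0≤d ⊛ p≤q⇒0≤q-p 1≤x₀
      ⊕ 0≤1-c ⊛ 0≤d
      ⊕ 0≤1-c ⊛ <⇒≤ (0<gap s₁)
      ⊕⁺ p<q⇒0<q-p (gap<1 s₂)))
      where
      identity :
        let K  = c * (1 - c) - (1 - d)
            g₁ = c * x₁ - d * x₀ - x₂
            g₂ = c * x₂ - d * x₁ - x₃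
        in K * (-1 - x₁) + K + (1 - c) * d * (x₀ - 1) + (1 - c) * d + (1 - c) * g₁ + (1 - g₂)
           ≡ x₃ - (x₂ - x₁ - 1)
      identity = solve (c ∷ d ∷ x₀ ∷ x₁ ∷ x₂ ∷ x₃ ∷ []) ℚ-ring

    x₂-x₁≤x₃⇒0<x₄ : ∀ {x₁ x₂ x₃ x₄} → x₁ ≤ -1 → x₂ ≤ -2 → x₂ - x₁ ≤ x₃ → Step c d x₂ x₃ x₄ → 0 < x₄
    x₂-x₁≤x₃⇒0<x₄ {x₁} {x₂} {x₃} {x₄} x₁≤-1 x₂≤-2 x₂-x₁≤x₃ s₃ = subst (0 <_) identity
      ( 0≤c ⊛ p≤q⇒0≤q-p x₂-x₁≤x₃
      ⊕ 0≤d-c ⊛ p≤q⇒0≤q-p x₂≤-2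
      ⊕ 0≤c ⊛ p≤q⇒0≤q-p x₁≤-1
      ⊕ 0≤2d-c-1
      ⊕⁺ p<q⇒0<q-p (gap<1 s₃))
      where
      identity :
        let g₃ = c * x₃ - d * x₂ - x₄
        in c * (x₃ - (x₂ - x₁)) + (d - c) * (-2 - x₂) + c * (-1 - x₁) + (2 * d - c - 1) + (1 - g₃)
           ≡ x₄
      identity = solve (c ∷ d ∷ x₁ ∷ x₂ ∷ x₃ ∷ x₄ ∷ []) ℚ-ring

    0≤x₃⇒x₁<-1 : ∀ {x₀ x₁ x₂ x₃} → 1 ≤ x₀ → 0 ≤ x₃ →
      Step c d x₀ x₁ x₂ → Step c d x₁ x₂ x₃ → x₁ < -1
    0≤x₃⇒x₁<-1 {x₀} {x₁} {x₂} {x₃} 1≤x₀ 0≤x₃ s₁ s₂ =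
      0<q-p⇒p<q (0<p*q⇒0<q 0≤d-c² (subst (0 <_) identity
        ( 0≤x₃
        ⊕ 0≤c ⊛ <⇒≤ (0<gap s₁)
        ⊕ 0≤c ⊛ 0≤d ⊛ p≤q⇒0≤q-p 1≤x₀
        ⊕ 0≤c²+cd-d
        ⊕⁺ 0<gap s₂)))
      where
      identity :
        let g₁ = c * x₁ - d * x₀ - x₂
            g₂ = c * x₂ - d * x₁ - x₃
        in x₃ + c * g₁ + c * d * (x₀ - 1) + (c * c + c * d - d) + g₂ ≡ (d - c * c) * (-1 - x₁)
      identity = solve (c ∷ d ∷ x₀ ∷ x₁ ∷ x₂ ∷ x₃ ∷ []) ℚ-ring

    1≤x₃⇒x₂<-3 : ∀ {x₀ x₁ x₂ x₃} → 1 ≤ x₀ → 1 ≤ x₃ →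
      Step c d x₀ x₁ x₂ → Step c d x₁ x₂ x₃ → x₂ < -3
    1≤x₃⇒x₂<-3 {x₀} {x₁} {x₂} {x₃} 1≤x₀ 1≤x₃ s₁ s₂ =
      0<q-p⇒p<q (0<p*q⇒0<q 0≤d-c² (subst (0 <_) identity
        ( 0≤c ⊛ p≤q⇒0≤q-p 1≤x₃
        ⊕ 0≤d ⊛ 0≤d ⊛ p≤q⇒0≤q-p 1≤x₀
        ⊕ 0≤d ⊛ <⇒≤ (0<gap s₁)
        ⊕ 0≤c ⊛ <⇒≤ (0<gap s₂)
        ⊕⁺ 0<3c²+c+d²-3d)))
      where
      identity :
        let g₁ = c * x₁ - d * x₀ - x₂
            g₂ = c * x₂ - d * x₁ - x₃
        in c * (x₃ - 1) + d * d * (x₀ - 1) + d * g₁ + c * g₂ + (3 * (c * c) + c + d * d - 3 * d)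
           ≡ (d - c * c) * (-3 - x₂)
      identity = solve (c ∷ d ∷ x₀ ∷ x₁ ∷ x₂ ∷ x₃ ∷ []) ℚ-ring

    x₂≤-4⇒0<x₅ : ∀ {x₀ x₁ x₂ x₃ x₄ x₅} → 1 ≤ x₀ → x₂ ≤ -4 →
      Step c d x₀ x₁ x₂ → Step c d x₁ x₂ x₃ → Step c d x₂ x₃ x₄ → Step c d x₃ x₄ x₅ → 0 < x₅
    x₂≤-4⇒0<x₅ {x₀} {x₁} {x₂} {x₃} {x₄} {x₅} 1≤x₀ x₂≤-4 s₁ s₂ s₃ s₄ =
      0<p*q⇒0<q 0≤c (subst (0 <_) identity
        ( 0≤G₁ ⊛ p≤q⇒0≤q-p x₂≤-4
        ⊕ 0≤d-c² ⊛ 0≤d ⊛ 0≤d ⊛ p≤q⇒0≤q-p 1≤x₀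
        ⊕ 0≤d-c² ⊛ 0≤d ⊛ <⇒≤ (0<gap s₁)
        ⊕ 0≤c ⊛ 0≤d-c² ⊛ <⇒≤ (0<gap s₂)
        ⊕ 0≤c ⊛ 0≤c ⊛ <⇒≤ (p<q⇒0<q-p (gap<1 s₃))
        ⊕ 0≤c ⊛ <⇒≤ (p<q⇒0<q-p (gap<1 s₄))
        ⊕⁺ 0<G₂))
      where
      identity :
        let e  = d - c * c
            G₁ = c * c * d - e * e
            G₂ = 4 * G₁ + e * d * d - c * c - c
            g₁ = c * x₁ - d * x₀ - x₂
            g₂ = c * x₂ - d * x₁ - x₃
            g₃ = c * x₃ - d * x₂ - x₄
            g₄ = c * x₄ - d * x₃ - x₅
        in G₁ * (-4 - x₂) + e * d * d * (x₀ - 1) + e * d * g₁ + c * e * g₂ + c * c * (1 - g₃)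
           + c * (1 - g₄) + G₂
           ≡ c * x₅
      identity = solve (c ∷ d ∷ x₀ ∷ x₁ ∷ x₂ ∷ x₃ ∷ x₄ ∷ x₅ ∷ []) ℚ-ring

    orbit-signs : ∀ {x₀ x₁ x₂ x₃ x₄ x₅} →
      IsInteger x₁ → IsInteger x₂ → IsInteger x₃ → IsInteger x₄ → 1 ≤ x₀ → x₁ ≤ -1 →
      Step c d x₀ x₁ x₂ → Step c d x₁ x₂ x₃ → Step c d x₂ x₃ x₄ → Step c d x₃ x₄ x₅ →
      x₂ < 0 × 0 < x₄ × 0 < x₅
    orbit-signs {x₀} {x₁} {x₂} {x₃} {x₄} {x₅} ℤx₁ ℤx₂ ℤx₃ ℤx₄ 1≤x₀ x₁≤-1 s₁ s₂ s₃ s₄ =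
      ≤-<-trans x₂≤-2 (negative⁻¹ -2) , 0<x₄ , 0<x₅
      where
      x₂≤-2 : x₂ ≤ -2
      x₂≤-2 = <+1⇒≤ ℤx₂ (-2 , refl) (<-≤-trans (step-upper-bound x₁≤-1 1≤x₀ s₁) c*-1-d*1≤-1)

      x₂-x₁≤x₃ : x₂ - x₁ ≤ x₃
      x₂-x₁≤x₃ = -1<⇒≤ (isInteger-‿ ℤx₂ ℤx₁) ℤx₃ (x₂-x₁-1<x₃ 1≤x₀ x₁≤-1 s₁ s₂)

      0<x₄ : 0 < x₄
      0<x₄ = x₂-x₁≤x₃⇒0<x₄ x₁≤-1 x₂≤-2 x₂-x₁≤x₃ s₃

      1≤x₄ : 1 ≤ x₄
      1≤x₄ = -1<⇒≤ (1 , refl) ℤx₄ 0<x₄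

      0≤x₃⇒0<x₅ : 0 ≤ x₃ → 0 < x₅
      0≤x₃⇒0<x₅ 0≤x₃ with 0 <? x₃
      ... | yes 0<x₃ = x₂≤-4⇒0<x₅ 1≤x₀ x₂≤-4 s₁ s₂ s₃ s₄
        where
        x₂≤-4 : x₂ ≤ -4
        x₂≤-4 = <+1⇒≤ ℤx₂ (-4 , refl) (1≤x₃⇒x₂<-3 1≤x₀ (-1<⇒≤ (1 , refl) ℤx₃ 0<x₃) s₁ s₂)
      ... | no 0≮x₃ = ≤-<-trans 0≤c*2-d*0-1 (step-lower-bound 2≤x₄ (≮⇒≥ 0≮x₃) s₄)
        where
        x₁≤-2 : x₁ ≤ -2
        x₁≤-2 = <+1⇒≤ ℤx₁ (-2 , refl) (0≤x₃⇒x₁<-1 1≤x₀ 0≤x₃ s₁ s₂)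

        x₂≤-3 : x₂ ≤ -3
        x₂≤-3 = <+1⇒≤ ℤx₂ (-3 , refl) (<-≤-trans (step-upper-bound x₁≤-2 1≤x₀ s₁) c*-2-d*1≤-2)

        2≤x₄ : 2 ≤ x₄
        2≤x₄ = -1<⇒≤ (2 , refl) ℤx₄ (≤-<-trans 1≤c*0-d*-3-1 (step-lower-bound 0≤x₃ x₂≤-3 s₃))

      0<x₅ : 0 < x₅
      0<x₅ with x₃ <? 0
      ... | yes x₃<0 =
        ≤-<-trans 0≤c*1-d*-1-1 (step-lower-bound 1≤x₄ (<+1⇒≤ ℤx₃ (-1 , refl) x₃<0) s₄)
      ... | no x₃≮0 = 0≤x₃⇒0<x₅ (≮⇒≥ x₃≮0)

  -- Rational brackets of β

  NearRoot : ℕ → (ℚ → Set) → Set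
  NearRoot n P = Σ[ B ∈ Bracket n ] (∀ t → Bracket.r B ≤ t → t ≤ Bracket.s B → P t)

  ⊓-preserves : ∀ (P : ℚ → Set) p q → P p → P q → P (p ⊓ q)
  ⊓-preserves P p q Pp Pq with ⊓-sel p q
  ... | inj₁ p⊓q≡p = subst P (sym p⊓q≡p) Pp
  ... | inj₂ p⊓q≡q = subst P (sym p⊓q≡q) Pq

  ⊔-preserves : ∀ (P : ℚ → Set) p q → P p → P q → P (p ⊔ q)
  ⊔-preserves P p q Pp Pq with ⊔-sel p q
  ... | inj₁ p⊔q≡p = subst P (sym p⊔q≡p) Pp
  ... | inj₂ p⊔q≡q = subst P (sym p⊔q≡q) Pq

  module _ {n : ℕ} where

    r≤s : (B : Bracket n) → Bracket.r B ≤ Bracket.s B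
    r≤s B = ≮⇒≥ λ s<r → <-asym (<-≤-trans 0<ε (above r (<⇒≤ s<r))) p[r]<0
      where open Bracket B

    meet : Bracket n → Bracket n → Bracket n
    meet B C = record
      { r      = B.r ⊔ C.r
      ; s      = B.s ⊓ C.s
      ; ε      = B.ε ⊓ C.ε
      ; 0<r    = <-≤-trans B.0<r (p≤p⊔q B.r C.r)
      ; p[r]<0 = ⊔-preserves (λ r → Defs.p n r < 0) B.r C.r B.p[r]<0 C.p[r]<0
      ; 0<ε    = ⊓-preserves (0 <_) B.ε C.ε B.0<ε C.0<ε
      ; above  = ⊓-preserves (λ s → ∀ t → s ≤ t → B.ε ⊓ C.ε ≤ Defs.p n t) B.s C.s
                   (λ t s≤t → ≤-trans (p⊓q≤p B.ε C.ε) (B.above t s≤t))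
                   (λ t s≤t → ≤-trans (p⊓q≤q B.ε C.ε) (C.above t s≤t))
      }
      where
      module B = Bracket B
      module C = Bracket C

    infixr 2 _∩_
    _∩_ : ∀ {P Q : ℚ → Set} → NearRoot n P → NearRoot n Q → NearRoot n (λ t → P t × Q t)
    (B , P-on-B) ∩ (C , Q-on-C) = meet B C , λ t r≤t t≤s →
      P-on-B t (≤-trans (p≤p⊔q B.r C.r) r≤t) (≤-trans t≤s (p⊓q≤p B.s C.s)) ,
      Q-on-C t (≤-trans (p≤q⊔p B.r C.r) r≤t) (≤-trans t≤s (p⊓q≤q B.s C.s))
      where
      module B = Bracket B
      module C = Bracket C

    nearRoot-witness : ∀ {P : ℚ → Set} → NearRoot n P → Σ ℚ P
    nearRoot-witness (B , P-on-B) = Bracket.r B , P-on-B (Bracket.r B) ≤-refl (r≤s B)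

    nearRoot-map : ∀ {P Q : ℚ → Set} → (∀ t → P t → Q t) → NearRoot n P → NearRoot n Q
    nearRoot-map P⇒Q (B , P-on-B) = B , λ t r≤t t≤s → P⇒Q t (P-on-B t r≤t t≤s)

    LtAtβ⇒nearRoot : ∀ {g c} → LtAtβ n g c → NearRoot n (λ t → g t < c)
    LtAtβ⇒nearRoot {g} (B , δ , 0<δ , g+δ≤c) = B , λ t r≤t t≤s →
      <-≤-trans (subst (_< g t + δ) (+-identityʳ (g t)) (+-monoʳ-< (g t) 0<δ)) (g+δ≤c t r≤t t≤s)

  4≤ℕ→ℚ : ∀ {n} → 4 ℕ.≤ n → 4 ≤ ℕ→ℚ n
  4≤ℕ→ℚ 4≤n = ℤ→ℚ-mono-≤ (ℤ.+≤+ 4≤n)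

  p-factorised : ∀ n t → Defs.p n t ≡ t * (t - 1) * (t - ℕ→ℚ n) - ℕ→ℚ n
  p-factorised n t = trans
    (cong (λ n+1 → t * t * t - n+1 * (t * t) + ℕ→ℚ n * t - ℕ→ℚ n) (ℤ→ℚ-+ 1 (+ n)))
    (factorise (ℕ→ℚ n) t)
    where
    factorise : ∀ N t → t * t * t - (1 + N) * (t * t) + N * t - N ≡ t * (t - 1) * (t - N) - N
    factorise N t = solve (N ∷ t ∷ []) ℚ-ring

  p[n]≡-n : ∀ n → Defs.p n (ℕ→ℚ n) ≡ - ℕ→ℚ n
  p[n]≡-n n = trans (p-factorised n (ℕ→ℚ n)) (vanish (ℕ→ℚ n))
    where
    vanish : ∀ N → N * (N - 1) * (N - N) - N ≡ - N
    vanish N = solve (N ∷ []) ℚ-ring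

  1/4≤t[t-1][t-N]-N : ∀ {N t} → 4 ≤ N → N + 3 / 10 ≤ t → 1 / 4 ≤ t * (t - 1) * (t - N) - N
  1/4≤t[t-1][t-N]-N {N} {t} 4≤N N+3/10≤t = 0≤q-p⇒p≤q (subst (0 ≤_) identity
    ( 32 / 25 ⊙ 0≤y ⊕ 3 / 10 ⊙ 0≤y ⊛ 0≤y
    ⊕ 1647 / 100 ⊙ 0≤x ⊕ 41 / 5 ⊙ 0≤x ⊛ 0≤y ⊕ 0≤x ⊛ 0≤y ⊛ 0≤y
    ⊕ 79 / 10 ⊙ 0≤x ⊛ 0≤x ⊕ 2 ⊙ 0≤x ⊛ 0≤x ⊛ 0≤y ⊕ 0≤x ⊛ 0≤x ⊛ 0≤x
    ⊕ nonNegative⁻¹ (7 / 1000)))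
    where
    identity :
      let x = t - (N + 3 / 10)
          y = N - 4
      in 32 / 25 * y + 3 / 10 * y * y + 1647 / 100 * x + 41 / 5 * x * y + x * y * y
         + 79 / 10 * x * x + 2 * x * x * y + x * x * x + 7 / 1000
         ≡ t * (t - 1) * (t - N) - N - 1 / 4
    identity = solve (N ∷ t ∷ []) ℚ-ring

    0≤y : 0 ≤ N - 4
    0≤y = p≤q⇒0≤q-p 4≤N
    0≤x : 0 ≤ t - (N + 3 / 10)
    0≤x = p≤q⇒0≤q-p N+3/10≤t

  β-bracket : ∀ {n} → 4 ℕ.≤ n → Bracket n
  β-bracket {n} 4≤n = record
    { r      = ℕ→ℚ n
    ; s      = ℕ→ℚ n + 3 / 10
    ; ε      = 1 / 4
    ; 0<r    = 0<n
    ; p[r]<0 = subst (_< 0) (sym (p[n]≡-n n)) (neg-antimono-< 0<n)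
    ; 0<ε    = positive⁻¹ (1 / 4)
    ; above  =
      λ t s≤t → subst (1 / 4 ≤_) (sym (p-factorised n t)) (1/4≤t[t-1][t-N]-N (4≤ℕ→ℚ 4≤n) s≤t)
      }
    where
    0<n : 0 < ℕ→ℚ n
    0<n = <-≤-trans (positive⁻¹ 4) (4≤ℕ→ℚ 4≤n)

  t*inv[t]≡1 : ∀ {t} → 0 < t → t * inv t ≡ 1
  t*inv[t]≡1 {t} 0<t with t ≟ 0ℚ
  ... | yes t≡0 = ⊥-elim (<-irrefl (sym t≡0) 0<t)
  ... | no t≢0 = trans (cong (t *_) (*-identityˡ _)) (*-inverseʳ t {{≢-nonZero t≢0}})

  0≤inv : ∀ {t} → 0 < t → 0 ≤ inv t
  0≤inv {t} 0<t = <⇒≤ (0<p*q⇒0<q (<⇒≤ 0<t) (subst (0 <_) (sym (t*inv[t]≡1 0<t)) (positive⁻¹ 1)))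

  t∈[N,N+3/10]⇒coefficients : ∀ {N t i} → 4 ≤ N → N ≤ t → t ≤ N + 3 / 10 → 0 ≤ i → t * i ≡ 1 →
    Coefficients (1 - (t - N)) (1 - (t - N) * i)
  t∈[N,N+3/10]⇒coefficients {N} {t} {i} 4≤N N≤t t≤N+3/10 0≤i t*i≡1 = record
    { 7/10≤c = 0≤q-p⇒p≤q (subst (0 ≤_) identity₁ (p≤q⇒0≤q-p t≤N+3/10))
    ; 3+c≤4d = 0≤q-p⇒p≤q (subst (0 ≤_) identity₂ (0≤t-N ⊛ 0≤i ⊛ 0≤t-4 ⊕ 0≤t-N ⊛ 0≤1-t*i))
    ; d≤1    = 0≤q-p⇒p≤q (subst (0 ≤_) identity₃ (0≤t-N ⊛ 0≤i))
    }
    where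
    identity₁ : N + 3 / 10 - t ≡ 1 - (t - N) - 7 / 10
    identity₁ = solve (N ∷ t ∷ []) ℚ-ring

    identity₂ : (t - N) * i * (t - 4) + (t - N) * (1 - t * i)
              ≡ 4 * (1 - (t - N) * i) - (3 + (1 - (t - N)))
    identity₂ = solve (N ∷ t ∷ i ∷ []) ℚ-ring

    identity₃ : (t - N) * i ≡ 1 - (1 - (t - N) * i)
    identity₃ = solve (N ∷ t ∷ i ∷ []) ℚ-ring

    0≤t-N : 0 ≤ t - N
    0≤t-N = p≤q⇒0≤q-p N≤t
    0≤t-4 : 0 ≤ t - 4
    0≤t-4 = p≤q⇒0≤q-p (≤-trans 4≤N N≤t)
    0≤1-t*i : 0 ≤ 1 - t * i
    0≤1-t*i = subst (λ ti → 0 ≤ 1 - ti) (sym t*i≡1) ≤-refl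

  coefficients-near-β : ∀ {n} → 4 ℕ.≤ n → NearRoot n (λ t → Coefficients (1 - α n t) (1 - α/β n t))
  coefficients-near-β 4≤n = β-bracket 4≤n , λ t n≤t t≤n+3/10 →
    let 0<t = <-≤-trans (positive⁻¹ 4) (≤-trans (4≤ℕ→ℚ 4≤n) n≤t)
    in t∈[N,N+3/10]⇒coefficients (4≤ℕ→ℚ 4≤n) n≤t t≤n+3/10 (0≤inv 0<t) (t*inv[t]≡1 0<t)

  -- τ_β on k-coordinates

  k-of : Triple → ℤ
  k-of (_ , k , _) = k

  StepAt : ℕ → ℚ → Triple → Triple → Triple → Set
  StepAt n t x y z = Step (1 - α n t) (1 - α/β n t) (ℤ→ℚ (k-of x)) (ℤ→ℚ (k-of y)) (ℤ→ℚ (k-of z))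

  step-near-β : ∀ {n} {x y z : Triple} → Tau n x y → InU* n y → Tau n y z →
    NearRoot n (λ t → StepAt n t x y z)
  step-near-β {n} {x} {l , k , j} {z} (_ , j≡kx , l≡0 , floor) ((_ , f<1) , y≢0) (kz≡k-j-l , _) =
    nearRoot-map step (LtAtβ⇒nearRoot (proj₂ (floor k,j≢0)) ∩ LtAtβ⇒nearRoot f<1)
    where
    k,j≢0 : ¬ (k ≡ 0 × j ≡ 0)
    k,j≢0 (k≡0 , j≡0) = y≢0 (cong₂ _,_ (l≡0 (k≡0 , j≡0)) (cong₂ _,_ k≡0 j≡0))

    gap≡f : ∀ t → (1 - α n t) * ℤ→ℚ k - (1 - α/β n t) * ℤ→ℚ (k-of x) - ℤ→ℚ (k-of z) ≡ f n l k j t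
    gap≡f t = trans
      (cong₂ (λ J K′ → (1 - α n t) * ℤ→ℚ k - (1 - α/β n t) * J - K′)
        (cong ℤ→ℚ (sym j≡kx))
        (trans (cong ℤ→ℚ kz≡k-j-l) (trans (ℤ→ℚ-‿ (k ℤ.- j) l) (cong (_- ℤ→ℚ l) (ℤ→ℚ-‿ k j)))))
      (rearrange (α n t) (α/β n t) (ℤ→ℚ l) (ℤ→ℚ k) (ℤ→ℚ j))
      where
      rearrange : ∀ a b L K J → (1 - a) * K - (1 - b) * J - (K - J - L) ≡ L - a * K + b * J
      rearrange a b L K J = solve (a ∷ b ∷ L ∷ K ∷ J ∷ []) ℚ-ring

    l-g≡f : ∀ t → ℤ→ℚ l - (α n t * ℤ→ℚ k - α/β n t * ℤ→ℚ j) ≡ f n l k j t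
    l-g≡f t = rearrange (α n t) (α/β n t) (ℤ→ℚ l) (ℤ→ℚ k) (ℤ→ℚ j)
      where
      rearrange : ∀ a b L K J → L - (a * K - b * J) ≡ L - a * K + b * J
      rearrange a b L K J = solve (a ∷ b ∷ L ∷ K ∷ J ∷ []) ℚ-ring

    l-1+1≡l : l ℤ.- 1 ℤ.+ 1 ≡ l
    l-1+1≡l = trans (ℤ.+-assoc l -1 1) (ℤ.+-identityʳ l)

    step : ∀ t →
      α n t * ℤ→ℚ k - α/β n t * ℤ→ℚ j < ℤ→ℚ (l ℤ.- 1 ℤ.+ 1) × f n l k j t < 1 →
      StepAt n t x (l , k , j) z
    step t (g<l , f<1) = record
      { 0<gap = subst (0 <_) (trans (l-g≡f t) (sym (gap≡f t)))
                  (p<q⇒0<q-p (subst (_ <_) (cong ℤ→ℚ l-1+1≡l) g<l))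
      ; gap<1 = subst (_< 1) (sym (gap≡f t)) f<1
      }

open import Defs
open import Data.Nat using (ℕ; suc; _≤_; z≤n; s≤s)
open import Data.Nat.Properties using (m≤n⇒m≤1+n)
open import Data.Integer using (0ℤ) renaming (_<_ to _<ℤ_)
import Data.Integer.Properties as ℤ
open import Data.Product using (_×_; proj₁; proj₂; _,_)
open import Relation.Binary.PropositionalEquality using (refl)

proposition3p8 : (n : ℕ) → 4 ≤ n → (x : ℕ → Triple) →
    (∀ i → i ≤ 4 → Tau n (x i) (x (suc i))) →
    (∀ i → i ≤ 5 → InU* n (x i)) →
    0ℤ <ℤ proj₁ (proj₂ (x 0)) → 0ℤ <ℤ proj₂ (proj₂ (x 0)) → proj₁ (proj₂ (x 1)) <ℤ 0ℤ →
    (proj₁ (proj₂ (x 2)) <ℤ 0ℤ) × (0ℤ <ℤ proj₁ (proj₂ (x 4))) × (0ℤ <ℤ proj₁ (proj₂ (x 5)))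
proposition3p8 n 4≤n x τ u* 0<k₀ _ k₁<0 =
  let _ , coefficients , s₁ , s₂ , s₃ , s₄ = nearRoot-witness
        ( coefficients-near-β 4≤n ∩ step 0 z≤n ∩ step 1 (s≤s z≤n)
        ∩ step 2 (s≤s (s≤s z≤n)) ∩ step 3 (s≤s (s≤s (s≤s z≤n))))
      k₂<0 , 0<k₄ , 0<k₅ = Orbit.orbit-signs coefficients
        (k-of (x 1) , refl) (k-of (x 2) , refl) (k-of (x 3) , refl) (k-of (x 4) , refl)
        (ℤ→ℚ-mono-≤ (ℤ.i<j⇒suc[i]≤j 0<k₀)) (ℤ→ℚ-mono-≤ (ℤ.i<j⇒i≤pred[j] k₁<0)) s₁ s₂ s₃ s₄
  in ℤ→ℚ-cancel-< k₂<0 , ℤ→ℚ-cancel-< 0<k₄ , ℤ→ℚ-cancel-< 0<k₅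
  where
  step : ∀ i → i ≤ 3 → NearRoot n (λ t → StepAt n t (x i) (x (suc i)) (x (suc (suc i))))
  step i i≤3 =
    step-near-β (τ i (m≤n⇒m≤1+n i≤3)) (u* (suc i) (m≤n⇒m≤1+n (s≤s i≤3))) (τ (suc i) (s≤s i≤3))
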